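{- Let $G$ be an undirected multigraph with vertex set $S \cup \mathcal{T}$ ($S\cap\mathcal{T}=\emptyset$), where every terminal in $\mathcal{T}$ has degree exactly one and is adjacent to a vertex of $S$, $|\partial(S)| = k$, and $G[S]$ is connected. If $k \ge 3$, then $S$ can be partitioned into at most $k-2$ sets, each of which is connectivity-$2$ linked in $G$.
   Context: For $X \subseteq S$, $\partial(X)$ is the set of edges of $G$ with exactly one endpoint in $X$, and $E_G(A,B)$ is the set of edges with one endpoint in $A$ and the other in $B$. A set $X \subseteq S$ is connectivity-$c$ linked in $G$ if for every partition $X = A\cup B$ into disjoint sets we have $|E_G(A,B)| \ge \min\big(|\partial(A)\cap\partial(X)|, |\partial(B)\cap\partial(X)|, c\big)$. -}

module Defs where

open import Data.Nat using (ℕ; zero; suc; _+_; _≤_; _⊓_; _∸_)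
open import Data.Bool using (Bool; true; false; _∧_; _∨_; not; _xor_; if_then_else_)
open import Data.Fin using (Fin)
open import Data.Fin.Properties using () renaming (_≟_ to _≟ᶠ_)
open import Data.List using (List; []; _∷_; length; filter)
open import Data.List.Membership.Propositional using (_∈_)
open import Data.Product using (_×_; _,_; proj₁; proj₂; Σ)
open import Data.Sum using (_⊎_)
open import Relation.Binary.PropositionalEquality using (_≡_)
open import Relation.Nullary.Decidable using (⌊_⌋)

-- A finite undirected multigraph on vertex set Fin n.  Edges are given as a
-- list of (unordered) endpoint pairs; parallel edges are repeated entries.
record MultiGraph (n : ℕ) : Set where
  field
    edges : List (Fin n × Fin n)
open MultiGraph public

VSet : ℕ → Set
VSet n = Fin n → Bool

_⊆_ : ∀ {n} → VSet n → VSet n → Set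
A ⊆ B = ∀ v → A v ≡ true → B v ≡ true

_∖_ : ∀ {n} → VSet n → VSet n → VSet n
(X ∖ A) v = X v ∧ not (A v)

countE : ∀ {n} → MultiGraph n → (Fin n × Fin n → Bool) → ℕ
countE G p = length (filter (λ e → p e ≟ᵇ true) (edges G))
  where
    open import Data.Bool.Properties using () renaming (_≟_ to _≟ᵇ_)

inBoundary : ∀ {n} → VSet n → Fin n × Fin n → Bool
inBoundary X (u , v) = X u xor X v

∂size : ∀ {n} → MultiGraph n → VSet n → ℕ
∂size G X = countE G (inBoundary X)

∂∩∂size : ∀ {n} → MultiGraph n → VSet n → VSet n → ℕ
∂∩∂size G A X = countE G (λ e → inBoundary A e ∧ inBoundary X e)

Esize : ∀ {n} → MultiGraph n → VSet n → VSet n → ℕ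
Esize G A B = countE G (λ { (u , v) → (A u ∧ B v) ∨ (B u ∧ A v) })

Linked : ∀ {n} → MultiGraph n → ℕ → VSet n → Set
Linked G c X = ∀ (A : VSet _) → A ⊆ X →
  (∂∩∂size G A X ⊓ ∂∩∂size G (X ∖ A) X) ⊓ c ≤ Esize G A (X ∖ A)

-- degree of vertex v (a loop counts twice)
degree : ∀ {n} → MultiGraph n → Fin n → ℕ
degree G v = countE G (λ e → ⌊ proj₁ e ≟ᶠ v ⌋) + countE G (λ e → ⌊ proj₂ e ≟ᶠ v ⌋)

Adjacent : ∀ {n} → MultiGraph n → Fin n → Fin n → Set
Adjacent G u w = ((u , w) ∈ edges G) ⊎ ((w , u) ∈ edges G)

data ReachIn {n} (G : MultiGraph n) (S : VSet n) : Fin n → Fin n → Set where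
  here : ∀ {u} → S u ≡ true → ReachIn G S u u
  step : ∀ {u w v} → S u ≡ true → Adjacent G u w → ReachIn G S w v →
         ReachIn G S u v

ConnectedIn : ∀ {n} → MultiGraph n → VSet n → Set
ConnectedIn G S = ∀ u v → S u ≡ true → S v ≡ true → ReachIn G S u v

-- The setting: vertices Fin n split into S (S v ≡ true) and terminals
-- 𝒯 (S v ≡ false); each terminal has degree exactly one and is adjacent
-- to a vertex of S.
TerminalsOK : ∀ {n} → MultiGraph n → VSet n → Set
TerminalsOK G S = ∀ t → S t ≡ false →
  (degree G t ≡ 1) × Σ (Fin _) (λ s → (S s ≡ true) × Adjacent G t s)

-- S is partitioned into the m classes {v ∈ S | p v ≡ i}, i : Fin m.
classOf : ∀ {n m} → VSet n → (Fin n → Fin m) → Fin m → VSet n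
classOf S p i v = S v ∧ ⌊ p v ≟ᶠ i ⌋

-- Induct on |∂X| for connected X with |∂X| ≥ 3. If X is 2-linked it forms a single
-- class. Otherwise some A ⊆ X with B = X ∖ A has |E(A,B)| < min(a, b, 2), where
-- a = |∂A ∩ ∂X| and b = |∂B ∩ ∂X|. Connectivity of X forces |E(A,B)| = 1, hence a, b ≥ 2,
-- and that single edge is the only exit from either side, so G[A] and G[B] stay connected.
-- Now |∂A| = a + 1 and |∂B| = b + 1 are at least 3 and smaller than |∂X| = a + b, so
-- induction splits A and B into at most (a - 1) + (b - 1) = |∂X| - 2 linked classes.
module Submission where

open import Data.Bool using (Bool; true; false; _∧_; _∨_; not; _xor_; if_then_else_; f≤t; b≤b)
  renaming (_≤_ to _≤ᵇ_)
open import Data.Bool.Properties using (∧-zeroʳ; ∧-identityʳ) renaming (_≟_ to _≟ᵇ_)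
open import Data.Fin using (Fin; zero; _↑ˡ_; _↑ʳ_; splitAt)
open import Data.Fin.Properties
  using (↑ˡ-injective; ↑ʳ-injective; splitAt-↑ˡ; splitAt-↑ʳ; join-splitAt)
  renaming (_≟_ to _≟ᶠ_)
open import Data.Fin.Subset.Properties using (anySubset?)
open import Data.List using (List; []; _∷_; length; filter)
open import Data.List.Membership.Propositional using (_∈_)
open import Data.List.Membership.Propositional.Properties using (∈-filter⁺; ∈-filter⁻)
open import Data.List.Properties using (filter-≐)
open import Data.List.Relation.Unary.Any using (here; there)
open import Data.Nat using (ℕ; suc; _+_; _∸_; _≤_; _<_; _⊓_; _≤?_; s≤s; z≤n)
open import Data.Nat.Induction using (<-rec)
open import Data.Nat.Properties
open import Data.Product using (Σ; ∃; _×_; _,_; proj₁; proj₂)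
open import Data.Sum using (_⊎_; inj₁; inj₂)
open import Data.Vec using (lookup; tabulate)
open import Data.Vec.Properties using (lookup∘tabulate)
open import Function using (_∘_; Injective)
open import Relation.Nullary using (¬_; Dec; yes; no; contradiction)
open import Relation.Nullary.Decidable using (isYes; ¬?; decidable-stable)
open import Relation.Binary.PropositionalEquality

open import Defs

𝟙 : Bool → ℕ
𝟙 b = if b then 1 else 0

module _ {A : Set} where

  true? : (p : A → Bool) (x : A) → Dec (p x ≡ true)
  true? p x = p x ≟ᵇ true

  count : (A → Bool) → List A → ℕ
  count p xs = length (filter (true? p) xs)

  count-cong : ∀ {p q} → p ≗ q → count p ≗ count q
  count-cong p≗q = cong length ∘ filter-≐ _ _ (trans (sym (p≗q _)) , trans (p≗q _))

  count-+ : ∀ {p q r} → (∀ x → 𝟙 (p x) ≡ 𝟙 (q x) + 𝟙 (r x)) →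
            ∀ xs → count p xs ≡ count q xs + count r xs
  count-+ _ [] = refl
  count-+ {p} {q} {r} split (x ∷ xs) with p x | q x | r x | split x
  ... | true  | true  | false | _ = cong suc (count-+ split xs)
  ... | true  | false | true  | _ = trans (cong suc (count-+ split xs)) (sym (+-suc _ _))
  ... | false | false | false | _ = count-+ split xs

  count-pos : ∀ {p} xs → 1 ≤ count p xs → ∃ λ x → x ∈ xs × p x ≡ true
  count-pos {p} (x ∷ xs) pos with p x in px
  ... | true  = x , here refl , px
  ... | false with count-pos xs pos
  ...   | y , y∈ , py = y , there y∈ , py

  count-≥1 : ∀ {p x xs} → x ∈ xs → p x ≡ true → 1 ≤ count p xs
  count-≥1 {p} {xs = xs} x∈ px with filter (true? p) xs | ∈-filter⁺ (true? p) x∈ px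
  ... | _ ∷ _ | _ = s≤s z≤n

  count≡1⇒unique : ∀ {p} xs → count p xs ≡ 1 →
    ∃ λ x → x ∈ xs × p x ≡ true × (∀ {y} → y ∈ xs → p y ≡ true → y ≡ x)
  count≡1⇒unique {p} xs one with filter (true? p) xs in eq
  ... | x ∷ [] with ∈-filter⁻ (true? p) (subst (x ∈_) (sym eq) (here refl))
  ...   | x∈ , px =
    x , x∈ , px , λ y∈ py → singleton (subst (_ ∈_) eq (∈-filter⁺ (true? p) y∈ py))
    where
    singleton : ∀ {y} → y ∈ x ∷ [] → y ≡ x
    singleton (here y≡x) = y≡x

⌊≟⌋-injective : ∀ {m k} {f : Fin m → Fin k} → Injective _≡_ _≡_ f →
                ∀ {a b} → isYes (f a ≟ᶠ f b) ≡ isYes (a ≟ᶠ b)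
⌊≟⌋-injective f-inj {a} {b} with a ≟ᶠ b
... | yes refl = cong isYes (≡-≟-identity _≟ᶠ_ refl)
... | no a≢b   = cong isYes (≢-≟-identity _≟ᶠ_ (a≢b ∘ f-inj))

⌊≟⌋-≢ : ∀ {m} {a b : Fin m} → a ≢ b → isYes (a ≟ᶠ b) ≡ false
⌊≟⌋-≢ a≢b = cong isYes (≢-≟-identity _≟ᶠ_ a≢b)

↑ʳ≢↑ˡ : ∀ {m k} (i : Fin k) (j : Fin m) → m ↑ʳ i ≢ j ↑ˡ k
↑ʳ≢↑ˡ {m} {k} i j eq
  with trans (sym (splitAt-↑ʳ m k i)) (trans (cong (splitAt m) eq) (splitAt-↑ˡ m j k))
... | ()

∸1+∸1 : ∀ {a b} → 1 ≤ a → 1 ≤ b → (a ∸ 1) + (b ∸ 1) ≡ (a + b) ∸ 2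
∸1+∸1 {suc a} {suc b} _ _ = cong (_∸ 1) (sym (+-suc a b))

-- Edge-by-edge forms of |∂X| = a + b, |∂A| = a + |E(A,B)| and |∂B| = b + |E(A,B)|:
-- au, xu (av, xv) say whether the endpoint u (v) lies in A and in X, and A ⊆ X becomes au ≤ xu.
∂X-split : ∀ au xu av xv → au ≤ᵇ xu → av ≤ᵇ xv →
  𝟙 (xu xor xv) ≡
  𝟙 ((au xor av) ∧ (xu xor xv)) + 𝟙 (((xu ∧ not au) xor (xv ∧ not av)) ∧ (xu xor xv))
∂X-split false false false false _ _ = refl
∂X-split false false false true  _ _ = refl
∂X-split false false true  true  _ _ = refl
∂X-split false true  false false _ _ = refl
∂X-split false true  false true  _ _ = refl
∂X-split false true  true  true  _ _ = refl
∂X-split true  true  false false _ _ = refl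
∂X-split true  true  false true  _ _ = refl
∂X-split true  true  true  true  _ _ = refl

∂A-split : ∀ au xu av xv → au ≤ᵇ xu → av ≤ᵇ xv →
  𝟙 (au xor av) ≡
  𝟙 ((au xor av) ∧ (xu xor xv)) + 𝟙 ((au ∧ (xv ∧ not av)) ∨ ((xu ∧ not au) ∧ av))
∂A-split false false false false _ _ = refl
∂A-split false false false true  _ _ = refl
∂A-split false false true  true  _ _ = refl
∂A-split false true  false false _ _ = refl
∂A-split false true  false true  _ _ = refl
∂A-split false true  true  true  _ _ = refl
∂A-split true  true  false false _ _ = refl
∂A-split true  true  false true  _ _ = refl
∂A-split true  true  true  true  _ _ = refl

∂B-split : ∀ au xu av xv → au ≤ᵇ xu → av ≤ᵇ xv →
  𝟙 ((xu ∧ not au) xor (xv ∧ not av)) ≡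
  𝟙 (((xu ∧ not au) xor (xv ∧ not av)) ∧ (xu xor xv)) +
  𝟙 ((au ∧ (xv ∧ not av)) ∨ ((xu ∧ not au) ∧ av))
∂B-split false false false false _ _ = refl
∂B-split false false false true  _ _ = refl
∂B-split false false true  true  _ _ = refl
∂B-split false true  false false _ _ = refl
∂B-split false true  false true  _ _ = refl
∂B-split false true  true  true  _ _ = refl
∂B-split true  true  false false _ _ = refl
∂B-split true  true  false true  _ _ = refl
∂B-split true  true  true  true  _ _ = refl

⊆⇒≤ᵇ : ∀ {n} {A X : VSet n} → A ⊆ X → ∀ v → A v ≤ᵇ X v
⊆⇒≤ᵇ {A = A} {X} A⊆X v with A v | X v | A⊆X v
... | false | false | _ = b≤b
... | false | true  | _ = f≤t
... | true  | true  | _ = b≤b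
... | true  | false | A⊆X = contradiction (A⊆X refl) λ ()

∖-intro : ∀ {n} {X A : VSet n} {v} → X v ≡ true → A v ≡ false → (X ∖ A) v ≡ true
∖-intro Xv Av rewrite Xv | Av = refl

∖-elim : ∀ {n} (X A : VSet n) {v} → (X ∖ A) v ≡ true → X v ≡ true × A v ≡ false
∖-elim X A {v} B with X v | A v
... | true | false = refl , refl

∖-⊆ : ∀ {n} {X A : VSet n} → (X ∖ A) ⊆ X
∖-⊆ {X = X} {A} v = proj₁ ∘ ∖-elim X A

∖-false : ∀ {n} (X A : VSet n) {v} → X v ≡ true → (X ∖ A) v ≡ false → A v ≡ true
∖-false X A {v} Xv Bv with X v | A v
... | true | true = refl
... | true | false = contradiction Bv λ ()
... | false | _ = contradiction Xv λ ()

∖-cong : ∀ {n} {X X' A A' : VSet n} → X ≗ X' → A ≗ A' → X ∖ A ≗ X' ∖ A'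
∖-cong X≗X' A≗A' v = cong₂ (λ x a → x ∧ not a) (X≗X' v) (A≗A' v)

_∩_ : ∀ {n} → VSet n → VSet n → VSet n
(X ∩ A) v = X v ∧ A v

∩-⊆ : ∀ {n} {X A : VSet n} → (X ∩ A) ⊆ X
∩-⊆ {X = X} v X∩A with X v
... | true = refl

∩-absorb : ∀ {n} {X A : VSet n} → A ⊆ X → X ∩ A ≗ A
∩-absorb {X = X} {A} A⊆X v with A v in Av
... | true  = cong (_∧ true) (A⊆X v Av)
... | false = ∧-zeroʳ (X v)

module _ {n} (G : MultiGraph n) where

  countE-cong : ∀ {p q} → p ≗ q → countE G p ≡ countE G q
  countE-cong p≗q = count-cong p≗q (edges G)

  countE-+ : ∀ {p q r} → (∀ e → 𝟙 (p e) ≡ 𝟙 (q e) + 𝟙 (r e)) →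
             countE G p ≡ countE G q + countE G r
  countE-+ split = count-+ split (edges G)

  module _ {X A : VSet n} (A⊆X : A ⊆ X) where

    ∂size-split : ∂size G X ≡ ∂∩∂size G A X + ∂∩∂size G (X ∖ A) X
    ∂size-split = countE-+ λ { (u , v) →
      ∂X-split (A u) (X u) (A v) (X v) (⊆⇒≤ᵇ A⊆X u) (⊆⇒≤ᵇ A⊆X v) }

    ∂size-inner : ∂size G A ≡ ∂∩∂size G A X + Esize G A (X ∖ A)
    ∂size-inner = countE-+ λ { (u , v) →
      ∂A-split (A u) (X u) (A v) (X v) (⊆⇒≤ᵇ A⊆X u) (⊆⇒≤ᵇ A⊆X v) }

    ∂size-outer : ∂size G (X ∖ A) ≡ ∂∩∂size G (X ∖ A) X + Esize G A (X ∖ A)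
    ∂size-outer = countE-+ λ { (u , v) →
      ∂B-split (A u) (X u) (A v) (X v) (⊆⇒≤ᵇ A⊆X u) (⊆⇒≤ᵇ A⊆X v) }

  inBoundary-cong : ∀ {A A' : VSet n} → A ≗ A' → inBoundary A ≗ inBoundary A'
  inBoundary-cong A≗A' (u , v) = cong₂ _xor_ (A≗A' u) (A≗A' v)

  ∂∩∂size-cong : ∀ {A A' X X'} → A ≗ A' → X ≗ X' →
                 ∂∩∂size G A X ≡ ∂∩∂size G A' X'
  ∂∩∂size-cong A≗A' X≗X' = countE-cong λ e →
    cong₂ _∧_ (inBoundary-cong A≗A' e) (inBoundary-cong X≗X' e)

  Esize-cong : ∀ {A A' B B'} → A ≗ A' → B ≗ B' → Esize G A B ≡ Esize G A' B'
  Esize-cong A≗A' B≗B' = countE-cong λ { (u , v) →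
    cong₂ _∨_ (cong₂ _∧_ (A≗A' u) (B≗B' v)) (cong₂ _∧_ (B≗B' u) (A≗A' v)) }

  LinkedAt : ℕ → VSet n → VSet n → Set
  LinkedAt c X A = (∂∩∂size G A X ⊓ ∂∩∂size G (X ∖ A) X) ⊓ c ≤ Esize G A (X ∖ A)

  LinkedAt-cong : ∀ {c X X' A A'} → X ≗ X' → A ≗ A' → LinkedAt c X A → LinkedAt c X' A'
  LinkedAt-cong {c} X≗X' A≗A' = subst₂ _≤_
    (cong (_⊓ c) (cong₂ _⊓_ (∂∩∂size-cong A≗A' X≗X')
                            (∂∩∂size-cong (∖-cong X≗X' A≗A') X≗X')))
    (Esize-cong A≗A' (∖-cong X≗X' A≗A'))

  Linked-cong : ∀ {c X Y} → X ≗ Y → Linked G c X → Linked G c Y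
  Linked-cong X≗Y linked A A⊆Y =
    LinkedAt-cong X≗Y (λ _ → refl) (linked A λ v → trans (X≗Y v) ∘ A⊆Y v)

  linkedAt? : ∀ c X A → Dec (LinkedAt c X A)
  linkedAt? c X A = _ ≤? _

  -- Exhaustive search over all subsets s of the vertices, tested as X ∩ s so that
  -- membership A ⊆ X never has to be decided.
  linked-or-violated : ∀ c X → Linked G c X ⊎ ∃ λ A → A ⊆ X × ¬ LinkedAt c X A
  linked-or-violated c X with anySubset? (λ s → ¬? (linkedAt? c X (X ∩ lookup s)))
  ... | yes (s , violated) = inj₂ (X ∩ lookup s , ∩-⊆ , violated)
  ... | no none = inj₁ λ A A⊆X →
    LinkedAt-cong (λ _ → refl)
      (λ v → trans (cong (X v ∧_) (lookup∘tabulate A v)) (∩-absorb A⊆X v))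
      (decidable-stable (linkedAt? c X _) λ violated → none (tabulate A , violated))

  Adjacent-sym : ∀ {u w} → Adjacent G u w → Adjacent G w u
  Adjacent-sym (inj₁ uw) = inj₂ uw
  Adjacent-sym (inj₂ wu) = inj₁ wu

  ReachIn-start : ∀ {X u v} → ReachIn G X u v → X u ≡ true
  ReachIn-start (here Xu) = Xu
  ReachIn-start (step Xu _ _) = Xu

  ReachIn-exit : ∀ {X P : VSet n} {u v} → ReachIn G X u v → P u ≡ true → P v ≡ false →
    ∃ λ u' → ∃ λ w → Adjacent G u' w × P u' ≡ true × X w ≡ true × P w ≡ false
  ReachIn-exit (here _) Pu Pv = contradiction (trans (sym Pu) Pv) λ ()
  ReachIn-exit {P = P} {u} (step {w = w} _ adj rest) Pu Pv with P w in Pw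
  ... | true  = ReachIn-exit rest Pw Pv
  ... | false = u , w , adj , Pu , ReachIn-start rest , Pw

  LeavesOnlyAt : VSet n → VSet n → Fin n → Set
  LeavesOnlyAt X P x =
    ∀ {u w} → Adjacent G u w → P u ≡ true → X w ≡ true → P w ≡ false → u ≡ x

  ReachIn-restrict : ∀ {X P : VSet n} {x} → LeavesOnlyAt X P x →
    ∀ {u v} → ReachIn G X u v → P v ≡ true →
    (P u ≡ true → ReachIn G P u v) × (P u ≡ false → ReachIn G P x v)
  ReachIn-restrict leaves (here _) Pv =
    (λ _ → here Pv) , (λ Pu → contradiction (trans (sym Pu) Pv) λ ())
  ReachIn-restrict {P = P} leaves (step {w = w} Xu adj rest) Pv
    with ReachIn-restrict leaves rest Pv | P w in Pw
  ... | fromInside , _ | true =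
    (λ Pu → step Pu adj (fromInside Pw)) ,
    (λ Pu → subst (λ z → ReachIn G P z _) (leaves (Adjacent-sym adj) Pw Xu Pu) (fromInside Pw))
  ... | _ , fromOutside | false =
    (λ Pu → subst (λ z → ReachIn G P z _) (sym (leaves adj Pu (ReachIn-start rest) Pw))
                  (fromOutside Pw)) ,
    (λ _ → fromOutside Pw)

  ConnectedIn-restrict : ∀ {X P : VSet n} {x} →
    ConnectedIn G X → P ⊆ X → LeavesOnlyAt X P x → ConnectedIn G P
  ConnectedIn-restrict conn P⊆X leaves u v Pu Pv =
    proj₁ (ReachIn-restrict leaves (conn u v (P⊆X u Pu) (P⊆X v Pv)) Pv) Pu

  -- Definitionally the predicate counted by Esize G A B.
  crossing : VSet n → VSet n → Fin n × Fin n → Bool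
  crossing A B (u , v) = (A u ∧ B v) ∨ (B u ∧ A v)

  endIn endOut : VSet n → Fin n × Fin n → Fin n
  endIn  A (u , v) = if A u then u else v
  endOut A (u , v) = if A u then v else u

  crossing-edge : ∀ {X A : VSet n} {u w} → Adjacent G u w → A u ≡ true → (X ∖ A) w ≡ true →
    ∃ λ e → e ∈ edges G × crossing A (X ∖ A) e ≡ true × endIn A e ≡ u × endOut A e ≡ w
  crossing-edge {X} {A} {u} {w} adj Au Bw with ∖-elim X A Bw
  ... | _ , Aw with adj
  ...   | inj₁ uw = (u , w) , uw , forward , cong (if_then u else w) Au , cong (if_then w else u) Au
    where
    forward : crossing A (X ∖ A) (u , w) ≡ true
    forward rewrite Au | Bw = refl
  ...   | inj₂ wu = (w , u) , wu , backward , cong (if_then w else u) Aw , cong (if_then u else w) Aw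
    where
    backward : crossing A (X ∖ A) (w , u) ≡ true
    backward rewrite Au | Bw | Aw = refl

  Esize-≥1 : ∀ {X A : VSet n} {s t} → ConnectedIn G X → A ⊆ X →
    A s ≡ true → (X ∖ A) t ≡ true → 1 ≤ Esize G A (X ∖ A)
  Esize-≥1 {X} {A} {s} {t} conn A⊆X As Bt with ∖-elim X A Bt
  ... | Xt , At with ReachIn-exit (conn s t (A⊆X s As) Xt) As At
  ... | _ , _ , adj , Au , Xw , Aw with crossing-edge {X} {A} adj Au (∖-intro {X = X} {A} Xw Aw)
  ... | _ , e∈ , crosses , _ = count-≥1 {p = crossing A (X ∖ A)} e∈ crosses

  bridge-connected : ∀ {X A : VSet n} → ConnectedIn G X → A ⊆ X → Esize G A (X ∖ A) ≡ 1 →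
    ConnectedIn G A × ConnectedIn G (X ∖ A)
  bridge-connected {X} {A} conn A⊆X one with count≡1⇒unique (edges G) one
  ... | e₀ , _ , _ , unique =
    ConnectedIn-restrict conn A⊆X leavesA , ConnectedIn-restrict conn ∖-⊆ leavesB
    where
    leavesA : LeavesOnlyAt X A (endIn A e₀)
    leavesA adj Au Xw Aw with crossing-edge adj Au (∖-intro {X = X} {A} Xw Aw)
    ... | e , e∈ , crosses , e-in≡u , _ = trans (sym e-in≡u) (cong (endIn A) (unique e∈ crosses))
    leavesB : LeavesOnlyAt X (X ∖ A) (endOut A e₀)
    leavesB adj Bu Xw Bw with crossing-edge (Adjacent-sym adj) (∖-false X A Xw Bw) Bu
    ... | e , e∈ , crosses , _ , e-out≡u = trans (sym e-out≡u) (cong (endOut A) (unique e∈ crosses))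

  LinkedPartition : ℕ → VSet n → ℕ → Set
  LinkedPartition c X m = Σ (Fin n → Fin m) λ p → ∀ i → Linked G c (classOf X p i)

  LinkedPartition-one : ∀ {c X} → Linked G c X → LinkedPartition c X 1
  LinkedPartition-one {X = X} linked =
    (λ _ → zero) , λ { zero → Linked-cong (sym ∘ ∧-identityʳ ∘ X) linked }

  LinkedPartition-+ : ∀ {c X A mA mB} → A ⊆ X →
    LinkedPartition c A mA → LinkedPartition c (X ∖ A) mB → LinkedPartition c X (mA + mB)
  LinkedPartition-+ {c} {X} {A} {mA} {mB} A⊆X (pA , linkedA) (pB , linkedB) = p , linked
    where
    p : Fin n → Fin (mA + mB)
    p v = if A v then pA v ↑ˡ mB else mA ↑ʳ pB v

    classOf-↑ˡ : ∀ j → classOf A pA j ≗ classOf X p (j ↑ˡ mB)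
    classOf-↑ˡ j v with A v in Av
    ... | true  rewrite A⊆X v Av = sym (⌊≟⌋-injective (↑ˡ-injective mB _ _))
    ... | false = sym (trans (cong (X v ∧_) (⌊≟⌋-≢ (↑ʳ≢↑ˡ (pB v) j))) (∧-zeroʳ (X v)))

    classOf-↑ʳ : ∀ j → classOf (X ∖ A) pB j ≗ classOf X p (mA ↑ʳ j)
    classOf-↑ʳ j v with A v
    ... | true  = trans (cong (_∧ _) (∧-zeroʳ (X v)))
                    (sym (trans (cong (X v ∧_) (⌊≟⌋-≢ (↑ʳ≢↑ˡ j (pA v) ∘ sym))) (∧-zeroʳ (X v))))
    ... | false = cong₂ _∧_ (∧-identityʳ (X v)) (sym (⌊≟⌋-injective (↑ʳ-injective mA _ _)))

    linked : ∀ i → Linked G c (classOf X p i)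
    linked i with splitAt mA i | join-splitAt mA mB i
    ... | inj₁ j | refl = Linked-cong (classOf-↑ˡ j) (linkedA j)
    ... | inj₂ j | refl = Linked-cong (classOf-↑ʳ j) (linkedB j)

  ∂∩∂size-nonempty : ∀ {A X : VSet n} → 1 ≤ ∂∩∂size G A X → ∃ λ v → A v ≡ true
  ∂∩∂size-nonempty {A} pos with count-pos (edges G) pos
  ... | (u , v) , _ , crosses with A u in Au | A v in Av
  ...   | true  | _    = u , Au
  ...   | false | true = v , Av

  violation-bounds : ∀ {X A : VSet n} → ConnectedIn G X → A ⊆ X → ¬ LinkedAt 2 X A →
    Esize G A (X ∖ A) ≡ 1 × 2 ≤ ∂∩∂size G A X × 2 ≤ ∂∩∂size G (X ∖ A) X
  violation-bounds {X} {A} conn A⊆X violated = e≡1 , subst (_< a) e≡1 e<a , subst (_< b) e≡1 e<b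
    where
    a b e : ℕ
    a = ∂∩∂size G A X
    b = ∂∩∂size G (X ∖ A) X
    e = Esize G A (X ∖ A)
    e<min : e < (a ⊓ b) ⊓ 2
    e<min = ≰⇒> violated
    e<a : e < a
    e<a = <-≤-trans e<min (≤-trans (m⊓n≤m _ 2) (m⊓n≤m a b))
    e<b : e < b
    e<b = <-≤-trans e<min (≤-trans (m⊓n≤m _ 2) (m⊓n≤n a b))
    e≡1 : e ≡ 1
    e≡1 with ∂∩∂size-nonempty {X = X} (<-≤-trans (s≤s z≤n) e<a)
           | ∂∩∂size-nonempty {X = X} (<-≤-trans (s≤s z≤n) e<b)
    ... | s , As | t , Bt =
      ≤-antisym (≤-pred (<-≤-trans e<min (m⊓n≤n _ 2))) (Esize-≥1 conn A⊆X As Bt)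

  LinkedDecomposition : VSet n → Set
  LinkedDecomposition X = ∃ λ m → m ≤ ∂size G X ∸ 2 × LinkedPartition 2 X m

  split-along-violation : ∀ {X A : VSet n} → ConnectedIn G X → A ⊆ X → ¬ LinkedAt 2 X A →
    (∀ Y → ∂size G Y < ∂size G X → ConnectedIn G Y → 3 ≤ ∂size G Y →
           LinkedDecomposition Y) →
    LinkedDecomposition X
  split-along-violation {X} {A} conn A⊆X violated ih =
    mA + mB , bound , LinkedPartition-+ A⊆X partA partB
    where
    open ≤-Reasoning
    B : VSet n
    B = X ∖ A
    a b : ℕ
    a = ∂∩∂size G A X
    b = ∂∩∂size G B X
    bounds = violation-bounds conn A⊆X violated
    e≡1 = proj₁ bounds
    2≤a = proj₁ (proj₂ bounds)
    2≤b = proj₂ (proj₂ bounds)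
    ∂A≡ : ∂size G A ≡ suc a
    ∂A≡ = trans (∂size-inner A⊆X) (trans (cong (a +_) e≡1) (+-comm a 1))
    ∂B≡ : ∂size G B ≡ suc b
    ∂B≡ = trans (∂size-outer A⊆X) (trans (cong (b +_) e≡1) (+-comm b 1))
    ∂X≡ : ∂size G X ≡ a + b
    ∂X≡ = ∂size-split A⊆X
    ∂A<∂X : ∂size G A < ∂size G X
    ∂A<∂X = subst₂ _<_ (sym ∂A≡) (sym ∂X≡)
                       (subst (suc a <_) (+-comm b a) (+-monoˡ-< a 2≤b))
    ∂B<∂X : ∂size G B < ∂size G X
    ∂B<∂X = subst₂ _<_ (sym ∂B≡) (sym ∂X≡) (+-monoˡ-< b 2≤a)
    conns = bridge-connected conn A⊆X e≡1
    decA = ih A ∂A<∂X (proj₁ conns) (subst (3 ≤_) (sym ∂A≡) (s≤s 2≤a))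
    decB = ih B ∂B<∂X (proj₂ conns) (subst (3 ≤_) (sym ∂B≡) (s≤s 2≤b))
    mA = proj₁ decA
    mB = proj₁ decB
    partA = proj₂ (proj₂ decA)
    partB = proj₂ (proj₂ decB)
    bound : mA + mB ≤ ∂size G X ∸ 2
    bound = begin
      mA + mB                           ≤⟨ +-mono-≤ (proj₁ (proj₂ decA)) (proj₁ (proj₂ decB)) ⟩
      (∂size G A ∸ 2) + (∂size G B ∸ 2) ≡⟨ cong₂ (λ x y → (x ∸ 2) + (y ∸ 2)) ∂A≡ ∂B≡ ⟩
      (a ∸ 1) + (b ∸ 1)                 ≡⟨ ∸1+∸1 (<⇒≤ 2≤a) (<⇒≤ 2≤b) ⟩
      (a + b) ∸ 2                       ≡⟨ cong (_∸ 2) ∂X≡ ⟨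
      ∂size G X ∸ 2                     ∎

  linkedDecomposition : ∀ X → ConnectedIn G X → 3 ≤ ∂size G X → LinkedDecomposition X
  linkedDecomposition X = <-rec Goal decompose (∂size G X) X refl
    where
    Goal : ℕ → Set
    Goal k = ∀ X → ∂size G X ≡ k → ConnectedIn G X → 3 ≤ k → LinkedDecomposition X
    decompose : ∀ k → (∀ {j} → j < k → Goal j) → Goal k
    decompose _ ih X refl conn 3≤∂X with linked-or-violated 2 X
    ... | inj₁ linked = 1 , ∸-monoˡ-≤ 2 3≤∂X , LinkedPartition-one linked
    ... | inj₂ (A , A⊆X , violated) =
      split-along-violation conn A⊆X violated λ Y ∂Y<∂X → ih ∂Y<∂X Y refl

mainTheorem3 : ∀ {n} (G : MultiGraph n) (S : VSet n) (k : ℕ) →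
    TerminalsOK G S → ∂size G S ≡ k → ConnectedIn G S → 3 ≤ k →
    Σ ℕ (λ m → (m ≤ k ∸ 2) × Σ (Fin n → Fin m) (λ p →
    ∀ (i : Fin m) → Linked G 2 (classOf S p i)))
mainTheorem3 G S _ _ refl = linkedDecomposition G S
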